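{- Let $\Sigma=\{0,1,\ldots,q-1\}$ and let $T=T[1\ldots n,1\ldots n]$ be an $n\times n$ matrix with entries in $\Sigma$. Then $T$ is bibifix-free if and only if $T[1\ldots r,1\ldots r]\neq T[n-r+1\ldots n,\,n-r+1\ldots n]$ for every $r=1,2,\ldots,\lfloor n/2\rfloor$.
   Context: For $1\le r<n$, the $r\times r$ biprefix of $T$ is the submatrix $T[1\ldots r,1\ldots r]$ (rows $1,\dots,r$, columns $1,\dots,r$), and the $r\times r$ bisuffix of $T$ is $T[n-r+1\ldots n,\,n-r+1\ldots n]$. A bibifix of $T$ is a square submatrix that is both a biprefix and a bisuffix of $T$, i.e. there is $1\le r<n$ with $T[1\ldots r,1\ldots r]=T[n-r+1\ldots n,\,n-r+1\ldots n]$. The matrix $T$ is bibifix-free if it has no bibifix, i.e. no biprefix of $T$ is also a bisuffix of $T$. -}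

module Defs where

open import Data.Nat using (ℕ; _≤_; _<_; _+_; _∸_; _/_; suc)
import Data.Nat.Properties
open Data.Nat.Properties using (m∸n+n≡m)
open import Data.Fin using (Fin; inject≤; _↑ʳ_; cast)
open import Data.Product using (∃-syntax; _×_)
open import Relation.Binary.PropositionalEquality using (_≡_)
open import Relation.Nullary using (¬_)

Matrix : ℕ → ℕ → Set
Matrix q n = Fin n → Fin n → Fin q

_≐_ : ∀ {q r} → Matrix q r → Matrix q r → Set
A ≐ B = ∀ i j → A i j ≡ B i j

biprefix : ∀ {q n} (T : Matrix q n) (r : ℕ) → r ≤ n → Matrix q r
biprefix T r r≤n i j = T (inject≤ i r≤n) (inject≤ j r≤n)

-- r×r bisuffix T[n-r+1..n, n-r+1..n] (requires r ≤ n):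
-- 0-indexed entry (i,j) is T at (n-r+i, n-r+j).
bisuffix : ∀ {q n} (T : Matrix q n) (r : ℕ) → r ≤ n → Matrix q r
bisuffix {n = n} T r r≤n i j =
  T (cast (m∸n+n≡m r≤n) (_↑ʳ_ (n ∸ r) i)) (cast (m∸n+n≡m r≤n) (_↑ʳ_ (n ∸ r) j))

HasBibifix : ∀ {q n} → Matrix q n → Set
HasBibifix {n = n} T =
  ∃[ r ] Σ' r
  where
    Σ' : ℕ → Set
    Σ' r = (1 ≤ r) × ∃[ r<n ] (biprefix T r (Data.Nat.Properties.<⇒≤ {r} {n} r<n)
                                ≐ bisuffix T r (Data.Nat.Properties.<⇒≤ {r} {n} r<n))

BibifixFree : ∀ {q n} → Matrix q n → Set
BibifixFree T = ¬ HasBibifix T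

open import Data.Nat.DivMod using (m/n≤m)
half-bound : ∀ {n r} → r ≤ n / 2 → r ≤ n
half-bound {n} r≤ = Data.Nat.Properties.≤-trans r≤ (m/n≤m n 2)

module Submission where

-- A bibifix of length r is the same thing as a diagonal period n − r of T on
-- its leading r×r window: T(x,y) = T(x + (n−r), y + (n−r)) for all x, y < r.
-- If r > n/2 the period p = n − r is shorter than r, and applying it twice
-- shows that T also has diagonal period 2p on the leading s×s window, where
-- s = r − p = n − 2p; that is, T has a strictly shorter bibifix of length s.
-- Iterating (well-founded descent on r) every bibifix can be shortened to
-- one of length at most ⌊n/2⌋, which gives the nontrivial direction of the
-- theorem; the other direction holds since 1 ≤ r ≤ ⌊n/2⌋ implies r < n.

open import Defs
open import Data.Nat using (ℕ; _≤_; _<_; _+_; _∸_; _*_; _/_; _≤?_)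
open import Data.Nat.Properties
open import Data.Nat.DivMod using (m/n*n≤m; m*n/n≡m; /-monoˡ-≤)
open import Data.Nat.Induction using (<-wellFounded)
open import Induction.WellFounded using (Acc; acc)
open import Data.Fin using (Fin; toℕ; fromℕ<; inject≤; _↑ʳ_; cast)
open import Data.Fin.Properties
  using (toℕ-injective; toℕ<n; toℕ-fromℕ<; toℕ-inject≤; toℕ-cast; toℕ-↑ʳ)
open import Data.Product using (Σ-syntax; ∃-syntax; _×_; _,_)
open import Function.Bundles using (_⇔_; mk⇔; Equivalence)
open import Relation.Binary.PropositionalEquality
open import Relation.Nullary using (¬_; yes; no)

open Equivalence using (to; from)

double : ∀ r → r * 2 ≡ r + r
double r = trans (*-comm r 2) (cong (r +_) (+-identityʳ r))

≤half⇒double≤ : ∀ {n r} → r ≤ n / 2 → r + r ≤ n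
≤half⇒double≤ {n} {r} r≤half = begin
  r + r      ≡⟨ double r ⟨
  r * 2      ≤⟨ *-monoˡ-≤ 2 r≤half ⟩
  n / 2 * 2  ≤⟨ m/n*n≤m n 2 ⟩
  n          ∎
  where open ≤-Reasoning

double≤⇒≤half : ∀ {n r} → r + r ≤ n → r ≤ n / 2
double≤⇒≤half {n} {r} 2r≤n = begin
  r          ≡⟨ m*n/n≡m r 2 ⟨
  r * 2 / 2  ≤⟨ /-monoˡ-≤ 2 (subst (_≤ n) (sym (double r)) 2r≤n) ⟩
  n / 2      ∎
  where open ≤-Reasoning

≤half⇒< : ∀ {n r} → 1 ≤ r → r ≤ n / 2 → r < n
≤half⇒< {r = r} 1≤r r≤half = <-≤-trans (m<m+n r 1≤r) (≤half⇒double≤ r≤half)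

≰half⇒<double : ∀ {n r} → ¬ r ≤ n / 2 → n < r + r
≰half⇒<double r≰half = ≰⇒> (λ 2r≤n → r≰half (double≤⇒≤half 2r≤n))

finBelow : ∀ {n k} (x : Fin n) → k ≤ toℕ x → Σ[ z ∈ Fin n ] toℕ z ≡ k
finBelow x k≤x = fromℕ< (≤-<-trans k≤x (toℕ<n x)) , toℕ-fromℕ< _

midpoint≤ : ∀ p {k m} → m ≡ p + p + k → p + k ≤ m
midpoint≤ p {k} m≡ =
  subst (p + k ≤_) (trans (sym (+-assoc p p k)) (sym m≡)) (m≤n+m (p + k) p)

toℕ-suffixIndex : ∀ {n r} (r≤n : r ≤ n) (i : Fin r) →
  toℕ (cast (m∸n+n≡m r≤n) ((n ∸ r) ↑ʳ i)) ≡ n ∸ r + toℕ i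
toℕ-suffixIndex {n} {r} r≤n i = trans (toℕ-cast _ _) (toℕ-↑ʳ (n ∸ r) i)

module _ {q n : ℕ} (T : Matrix q n) where

  DiagonalPeriod : ℕ → ℕ → Set
  DiagonalPeriod r d = ∀ (x y x' y' : Fin n) → toℕ x < r → toℕ y < r →
    toℕ x' ≡ d + toℕ x → toℕ y' ≡ d + toℕ y → T x y ≡ T x' y'

  bibifix⇔period : ∀ r (r≤n : r ≤ n) →
    (biprefix T r r≤n ≐ bisuffix T r r≤n) ⇔ DiagonalPeriod r (n ∸ r)
  bibifix⇔period r r≤n = mk⇔ toPeriod toBibifix
    where
      prefixIndex : (x : Fin n) (x<r : toℕ x < r) → inject≤ (fromℕ< x<r) r≤n ≡ x
      prefixIndex x x<r = toℕ-injective (trans (toℕ-inject≤ _ r≤n) (toℕ-fromℕ< x<r))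

      suffixIndex : (x x' : Fin n) (x<r : toℕ x < r) → toℕ x' ≡ n ∸ r + toℕ x →
        cast (m∸n+n≡m r≤n) ((n ∸ r) ↑ʳ fromℕ< x<r) ≡ x'
      suffixIndex x x' x<r x'≡ = toℕ-injective (trans (toℕ-suffixIndex r≤n _)
        (trans (cong (n ∸ r +_) (toℕ-fromℕ< x<r)) (sym x'≡)))

      toPeriod : biprefix T r r≤n ≐ bisuffix T r r≤n → DiagonalPeriod r (n ∸ r)
      toPeriod eq x y x' y' x<r y<r x'≡ y'≡ = begin
        T x y
          ≡⟨ cong₂ T (prefixIndex x x<r) (prefixIndex y y<r) ⟨
        biprefix T r r≤n (fromℕ< x<r) (fromℕ< y<r)
          ≡⟨ eq (fromℕ< x<r) (fromℕ< y<r) ⟩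
        bisuffix T r r≤n (fromℕ< x<r) (fromℕ< y<r)
          ≡⟨ cong₂ T (suffixIndex x x' x<r x'≡) (suffixIndex y y' y<r y'≡) ⟩
        T x' y' ∎
        where open ≡-Reasoning

      toBibifix : DiagonalPeriod r (n ∸ r) → biprefix T r r≤n ≐ bisuffix T r r≤n
      toBibifix per i j = per _ _ _ _ (inWindow i) (inWindow j)
          (shifted i) (shifted j)
        where
          inWindow : (i : Fin r) → toℕ (inject≤ i r≤n) < r
          inWindow i = subst (_< r) (sym (toℕ-inject≤ i r≤n)) (toℕ<n i)

          shifted : (i : Fin r) → toℕ (cast (m∸n+n≡m r≤n) ((n ∸ r) ↑ʳ i))
                                  ≡ n ∸ r + toℕ (inject≤ i r≤n)
          shifted i = trans (toℕ-suffixIndex r≤n i)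
            (cong (n ∸ r +_) (sym (toℕ-inject≤ i r≤n)))

  period-doubling : ∀ p s → DiagonalPeriod (p + s) p → DiagonalPeriod s (p + p)
  -- The intermediate entry (z,w) = (x + p, y + p) links (x,y) to (x', y').
  period-doubling p s per x y x' y' x<s y<s x'≡ y'≡
    with finBelow x' (midpoint≤ p x'≡) | finBelow y' (midpoint≤ p y'≡)
  ... | z , z≡ | w , w≡ =
    trans (per x y z w (inWindow x<s) (inWindow y<s) z≡ w≡)
          (per z w x' y' (shifted z≡ x<s) (shifted w≡ y<s) (reassoc x'≡ z≡) (reassoc y'≡ w≡))
    where
      inWindow : ∀ {k} → k < s → k < p + s
      inWindow k<s = ≤-trans k<s (m≤n+m s p)

      shifted : ∀ {k m} → m ≡ p + k → k < s → m < p + s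
      shifted m≡ k<s = subst (_< p + s) (sym m≡) (+-monoʳ-< p k<s)

      reassoc : ∀ {k m e} → e ≡ p + p + k → m ≡ p + k → e ≡ p + m
      reassoc {k} e≡ m≡ = trans e≡ (trans (+-assoc p p k) (cong (p +_) (sym m≡)))

  -- A border of length r, i.e. a bibifix, in the language of diagonal periods.
  Border : ℕ → Set
  Border r = 1 ≤ r × r < n × DiagonalPeriod r (n ∸ r)

  shorter-border : ∀ {r} → Border r → n < r + r → ∃[ s ] s < r × Border s
  shorter-border {r} (1≤r , r<n , per) n<2r =
    s , s<r , m<n⇒0<n∸m p<r , <-trans s<r r<n ,
    subst (DiagonalPeriod s) (sym n∸s≡2p)
      (period-doubling p s (subst (λ k → DiagonalPeriod k p) (sym p+s≡r) per))
    where
      p = n ∸ r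
      s = r ∸ p

      p+r≡n : p + r ≡ n
      p+r≡n = m∸n+n≡m (<⇒≤ r<n)

      p<r : p < r
      p<r = +-cancelʳ-< r p r (subst (_< r + r) (sym p+r≡n) n<2r)

      p+s≡r : p + s ≡ r
      p+s≡r = m+[n∸m]≡n (<⇒≤ p<r)

      s<r : s < r
      s<r = subst (s <_) p+s≡r (m<n+m s (m<n⇒0<n∸m r<n))

      n∸s≡2p : n ∸ s ≡ p + p
      n∸s≡2p = begin
        n ∸ s            ≡⟨ cong (_∸ s) p+r≡n ⟨
        p + r ∸ s        ≡⟨ cong (λ k → p + k ∸ s) p+s≡r ⟨
        p + (p + s) ∸ s  ≡⟨ cong (_∸ s) (+-assoc p p s) ⟨
        p + p + s ∸ s    ≡⟨ m+n∸n≡m (p + p) s ⟩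
        p + p            ∎
        where open ≡-Reasoning

  short-border : ∀ {r} → Border r → ∃[ s ] s ≤ n / 2 × Border s
  short-border {r} = descend r (<-wellFounded r)
    where
      descend : ∀ r → Acc _<_ r → Border r → ∃[ s ] s ≤ n / 2 × Border s
      descend r (acc shorter) b with r ≤? n / 2
      ... | yes r≤half = r , r≤half , b
      ... | no r≰half with shorter-border b (≰half⇒<double r≰half)
      ...   | s , s<r , b' = descend s (shorter s<r) b'

proposition2p2 : (q n : ℕ) (T : Matrix q n) →
    BibifixFree T ⇔
      ((r : ℕ) → 1 ≤ r → (h : r ≤ n / 2) →
        ¬ (biprefix T r (half-bound h) ≐ bisuffix T r (half-bound h)))
proposition2p2 q n T = mk⇔ noShortBibifix noBibifix
  where
    noShortBibifix : BibifixFree T → (r : ℕ) → 1 ≤ r → (h : r ≤ n / 2) →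
      ¬ (biprefix T r (half-bound h) ≐ bisuffix T r (half-bound h))
    noShortBibifix free r 1≤r r≤half eq = free (r , 1≤r , r<n ,
        from (bibifix⇔period T r (<⇒≤ r<n))
          (to (bibifix⇔period T r (half-bound r≤half)) eq))
      where r<n = ≤half⇒< 1≤r r≤half

    noBibifix : ((r : ℕ) → 1 ≤ r → (h : r ≤ n / 2) →
      ¬ (biprefix T r (half-bound h) ≐ bisuffix T r (half-bound h))) → BibifixFree T
    noBibifix noShort (r , 1≤r , r<n , eq)
      with short-border T (1≤r , r<n , to (bibifix⇔period T r (<⇒≤ r<n)) eq)
    ... | s , s≤half , 1≤s , _ , per =
      noShort s 1≤s s≤half (from (bibifix⇔period T s (half-bound s≤half)) per)
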